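{- Let $p$ and $q$ be distinct atoms. No nondisjunctive nested program is strongly equivalent to the nested program $\{p;q\}$ (consisting of the single rule $(p;q)\leftarrow\top$).
   Context: Fix a set of propositional atoms. A literal is an atom $A$ or its classical negation $\neg A$; a set of literals is consistent if it does not contain both $A$ and $\neg A$. Elementary formulas are literals and $\bot$, $\top$. Formulas are built from elementary formulas using the unary connective $\mathit{not}$ and binary connectives "$,$" (conjunction) and "$;$" (disjunction). A rule is $F\leftarrow G$ with formulas $F,G$; a nested program is a set of rules. A nested program is nondisjunctive if the head of each rule is an elementary formula possibly preceded by $\mathit{not}$. For consistent $X$: for elementary $F$, $X\models F$ iff $F\in X$ or $F=\top$; $X\models(F,G)$ iff both; $X\models(F;G)$ iff either; $X\models\mathit{not}\,F$ iff $X\not\models F$. $X$ satisfies $F\leftarrow G$ if $X\models G$ implies $X\models F$; $X$ satisfies a program if it satisfies all its rules. The reduct $F^X$ replaces each maximal occurrence of a subformula $\mathit{not}\,G$ by $\bot$ if $X\models G$ and by $\top$ otherwise; $P^X$ replaces head and body of each rule by their reducts. $X$ is an answer set of $P$ if it is minimal among consistent sets of literals satisfying $P^X$. Nested programs $P,Q$ are strongly equivalent if for every nested program $R$, $P\cup R$ and $Q\cup R$ have the same answer sets. -}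

module Defs where

open import Data.Empty using (⊥)
open import Data.Unit using (⊤)
open import Data.Product using (Σ; _×_)
open import Data.Sum using (_⊎_)
open import Relation.Nullary using (¬_)
open import Relation.Binary.PropositionalEquality using (_≡_)
open import Level using (Level) renaming (suc to lsuc; zero to lzero)

module NestedPrograms (Atom : Set) where

  -- literals: an atom or its classical negation
  data Literal : Set where
    pos : Atom → Literal
    neg : Atom → Literal

  LitSet : Set₁
  LitSet = Literal → Set

  _⊆_ : LitSet → LitSet → Set
  X ⊆ Y = ∀ l → X l → Y l

  Consistent : LitSet → Set
  Consistent X = ∀ a → X (pos a) → X (neg a) → ⊥

  -- formulas built from elementary formulas with not, "," and ";"
  infixr 6 _∧_
  infixr 5 _∨_
  data Formula : Set where
    lit  : Literal → Formula
    bot  : Formula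
    top  : Formula
    not  : Formula → Formula
    _∧_ : Formula → Formula → Formula
    _∨_ : Formula → Formula → Formula

  data Elementary : Formula → Set where
    el-lit : ∀ l → Elementary (lit l)
    el-bot : Elementary bot
    el-top : Elementary top

  record Rule : Set where
    constructor _⟵_
    field
      head : Formula
      body : Formula
  open Rule public

  Program : Set₁
  Program = Rule → Set

  _∪_ : Program → Program → Program
  (P ∪ R) r = P r ⊎ R r

  _⊨_ : LitSet → Formula → Set
  X ⊨ lit l   = X l
  X ⊨ bot     = ⊥
  X ⊨ top     = ⊤
  X ⊨ not F   = ¬ (X ⊨ F)
  X ⊨ (F ∧ G) = (X ⊨ F) × (X ⊨ G)
  X ⊨ (F ∨ G) = (X ⊨ F) ⊎ (X ⊨ G)

  -- Y ⊨ F^X : satisfaction of the reduct of F relative to X.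
  -- Each maximal occurrence of (not G) is replaced by ⊥ if X ⊨ G and by ⊤
  -- otherwise, i.e. it is satisfied exactly when ¬ (X ⊨ G).
  _⊨red[_]_ : LitSet → LitSet → Formula → Set
  Y ⊨red[ X ] lit l   = Y l
  Y ⊨red[ X ] bot     = ⊥
  Y ⊨red[ X ] top     = ⊤
  Y ⊨red[ X ] not G   = ¬ (X ⊨ G)
  Y ⊨red[ X ] (F ∧ G) = (Y ⊨red[ X ] F) × (Y ⊨red[ X ] G)
  Y ⊨red[ X ] (F ∨ G) = (Y ⊨red[ X ] F) ⊎ (Y ⊨red[ X ] G)

  SatisfiesReduct : LitSet → Program → LitSet → Set
  SatisfiesReduct Y P X =
    ∀ r → P r → Y ⊨red[ X ] body r → Y ⊨red[ X ] head r

  AnswerSet : Program → LitSet → Set₁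
  AnswerSet P X =
    Consistent X × SatisfiesReduct X P X ×
    (∀ (Y : LitSet) → Consistent Y → SatisfiesReduct Y P X → Y ⊆ X → X ⊆ Y)

  _⇔_ : Set₁ → Set₁ → Set₁
  A ⇔ B = (A → B) × (B → A)

  StronglyEquivalent : Program → Program → Set₁
  StronglyEquivalent P Q =
    ∀ (R : Program) (X : LitSet) → AnswerSet (P ∪ R) X ⇔ AnswerSet (Q ∪ R) X

  NondisjunctiveHead : Formula → Set
  NondisjunctiveHead F = Elementary F ⊎ Σ Formula (λ G → (F ≡ not G) × Elementary G)

  Nondisjunctive : Program → Set
  Nondisjunctive P = ∀ r → P r → NondisjunctiveHead (head r)

  DisjProgram : Atom → Atom → Program
  DisjProgram p q r = r ≡ ((lit (pos p) ∨ lit (pos q)) ⟵ top)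

{-# OPTIONS --safe #-}
-- Let Y = {p, q}. It is an answer set of {p ; q} ∪ {p ← q, q ← p}, hence of
-- P ∪ {p ← q, q ← p}, so Y is a model of P^Y. No rule of P with head p can
-- have a body that ∅ satisfies in the reduct: otherwise Y would be an answer
-- set of P ∪ {q ←}, but it is not one of {p ; q} ∪ {q ←}, where {q} is a
-- smaller model (symmetrically for q). Every other nondisjunctive head that
-- Y satisfies in the reduct is satisfied there by every set, so ∅ is a model
-- of (P ∪ {p ← q, q ← p})^Y, contradicting the minimality of Y.
module Submission where

open import Defs
open import Function using (id; _∘_)
open import Relation.Nullary using (¬_)
open import Relation.Binary.PropositionalEquality using (_≢_; _≡_; refl; sym)
open import Data.Empty using (⊥; ⊥-elim)
open import Data.Unit using (tt)
open import Data.Product using (Σ; _×_; _,_; proj₁; proj₂)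
open import Data.Sum using (_⊎_; inj₁; inj₂)
import Data.Sum as Sum

module _ {Atom : Set} where
  open NestedPrograms Atom

  pos-injective : ∀ {a b} → pos a ≡ pos b → a ≡ b
  pos-injective refl = refl

  ∅ : LitSet
  ∅ _ = ⊥

  ∅-consistent : Consistent ∅
  ∅-consistent _ ()

  ∅-⊆ : ∀ {X} → ∅ ⊆ X
  ∅-⊆ _ ()

  Singleton : Atom → LitSet
  Singleton a l = l ≡ pos a

  Pair : Atom → Atom → LitSet
  Pair a b l = l ≡ pos a ⊎ l ≡ pos b

  Pair-swap : ∀ {a b} → Pair a b ⊆ Pair b a
  Pair-swap _ (inj₁ eq) = inj₂ eq
  Pair-swap _ (inj₂ eq) = inj₁ eq

  Pair-consistent : ∀ {a b} → Consistent (Pair a b)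
  Pair-consistent _ _ (inj₁ ())
  Pair-consistent _ _ (inj₂ ())

  ⊨red-mono : ∀ {X Z Z′} → Z ⊆ Z′ → ∀ F → Z ⊨red[ X ] F → Z′ ⊨red[ X ] F
  ⊨red-mono Z⊆Z′ (lit l)  z        = Z⊆Z′ l z
  ⊨red-mono Z⊆Z′ top      z        = z
  ⊨red-mono Z⊆Z′ (not F)  z        = z
  ⊨red-mono Z⊆Z′ (F ∧ G)  (f , g)  = ⊨red-mono Z⊆Z′ F f , ⊨red-mono Z⊆Z′ G g
  ⊨red-mono Z⊆Z′ (F ∨ G)  (inj₁ f) = inj₁ (⊨red-mono Z⊆Z′ F f)
  ⊨red-mono Z⊆Z′ (F ∨ G)  (inj₂ g) = inj₂ (⊨red-mono Z⊆Z′ G g)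

  nondisjunctiveHead-reduct : ∀ {X Y F} → NondisjunctiveHead F → Y ⊨red[ X ] F →
    Σ Literal (λ l → F ≡ lit l × Y l) ⊎ (∀ Z → Z ⊨red[ X ] F)
  nondisjunctiveHead-reduct (inj₁ (el-lit l))      y   = inj₁ (l , refl , y)
  nondisjunctiveHead-reduct (inj₁ el-top)          _   = inj₂ (λ _ → tt)
  nondisjunctiveHead-reduct (inj₂ (_ , refl , _))  ¬XG = inj₂ (λ _ → ¬XG)

  SatisfiesReduct-∪ : ∀ {Z P R X} →
    SatisfiesReduct Z P X → SatisfiesReduct Z R X → SatisfiesReduct Z (P ∪ R) X
  SatisfiesReduct-∪ zP zR r (inj₁ Pr) = zP r Pr
  SatisfiesReduct-∪ zP zR r (inj₂ Rr) = zR r Rr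

  Forced : Program → LitSet → Literal → Set₁
  Forced P X l = ∀ Z → SatisfiesReduct Z P X → Z l

  Forced-∪ˡ : ∀ {P R X l} → Forced P X l → Forced (P ∪ R) X l
  Forced-∪ˡ forced Z z = forced Z (λ r Pr → z r (inj₁ Pr))

  Forced-∪ʳ : ∀ {P R X l} → Forced R X l → Forced (P ∪ R) X l
  Forced-∪ʳ forced Z z = forced Z (λ r Rr → z r (inj₂ Rr))

  Forced-by-rule : ∀ {P X l r} → P r → head r ≡ lit l → ∅ ⊨red[ X ] body r → Forced P X l
  Forced-by-rule {r = _ ⟵ B} Pr refl ∅⊨B Z z = z _ Pr (⊨red-mono ∅-⊆ B ∅⊨B)

  answerSet-if-forced : ∀ {P X} → Consistent X → SatisfiesReduct X P X →
    (∀ l → X l → Forced P X l) → AnswerSet P X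
  answerSet-if-forced cons model forced =
    cons , model , λ Z _ z _ l Xl → forced l Xl Z z

  answerSet-empty-if-∅-model : ∀ {P X} → AnswerSet P X → SatisfiesReduct ∅ P X → ∀ l → ¬ X l
  answerSet-empty-if-∅-model (_ , _ , minimal) ∅-model =
    minimal ∅ ∅-consistent ∅-model ∅-⊆

  Fact : Atom → Program
  Fact a r = r ≡ (lit (pos a) ⟵ top)

  Loop : Atom → Atom → Program
  Loop a b r = r ≡ (lit (pos a) ⟵ lit (pos b)) ⊎ r ≡ (lit (pos b) ⟵ lit (pos a))

  Forced-fact : ∀ {a X} → Forced (Fact a) X (pos a)
  Forced-fact Z z = z _ refl tt

  ∅-model-loop : ∀ {a b X} → SatisfiesReduct ∅ (Loop a b) X
  ∅-model-loop _ (inj₁ refl) ()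
  ∅-model-loop _ (inj₂ refl) ()

  answerSet-disj-loop : ∀ {p q} → AnswerSet (DisjProgram p q ∪ Loop p q) (Pair p q)
  answerSet-disj-loop = answerSet-if-forced Pair-consistent model forced
    where
    model : SatisfiesReduct (Pair _ _) (DisjProgram _ _ ∪ Loop _ _) (Pair _ _)
    model _ (inj₁ refl)         _ = inj₁ (inj₁ refl)
    model _ (inj₂ (inj₁ refl))  _ = inj₁ refl
    model _ (inj₂ (inj₂ refl))  _ = inj₂ refl

    forced : ∀ l → Pair _ _ l → Forced (DisjProgram _ _ ∪ Loop _ _) (Pair _ _) l
    forced _ Pl Z z with z _ (inj₁ refl) tt | Pl
    ... | inj₁ zp | inj₁ refl = zp
    ... | inj₁ zp | inj₂ refl = z _ (inj₂ (inj₂ refl)) zp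
    ... | inj₂ zq | inj₁ refl = z _ (inj₂ (inj₁ refl)) zq
    ... | inj₂ zq | inj₂ refl = zq

  answerSet-disj-fact-⊆ : ∀ {p q x X} → Pair p q (pos x) →
    AnswerSet (DisjProgram p q ∪ Fact x) X → X ⊆ Singleton x
  answerSet-disj-fact-⊆ {x = x} {X} x∈pq (_ , model , minimal) =
    minimal (Singleton x) cons singleton-model singleton-⊆
    where
    cons : Consistent (Singleton x)
    cons _ refl ()

    singleton-model : SatisfiesReduct (Singleton x) (DisjProgram _ _ ∪ Fact x) X
    singleton-model _ (inj₁ refl) _ = Sum.map sym sym x∈pq
    singleton-model _ (inj₂ refl) _ = refl

    singleton-⊆ : Singleton x ⊆ X
    singleton-⊆ _ refl = model _ (inj₂ refl) tt

  module _ {p q : Atom} {P : Program} (equiv : StronglyEquivalent P (DisjProgram p q)) where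

    answerSet-P-loop : AnswerSet (P ∪ Loop p q) (Pair p q)
    answerSet-P-loop = proj₂ (equiv (Loop p q) (Pair p q)) answerSet-disj-loop

    Pair-model : SatisfiesReduct (Pair p q) P (Pair p q)
    Pair-model r Pr = proj₁ (proj₂ answerSet-P-loop) r (inj₁ Pr)

    ¬Forced-second : ∀ {x z} → z ≢ x → Pair p q ⊆ Pair x z → Pair x z ⊆ Pair p q →
      ¬ Forced P (Pair p q) (pos z)
    ¬Forced-second {x} {z} z≢x pq⊆xz xz⊆pq forced =
      z≢x (pos-injective (answerSet-disj-fact-⊆ (xz⊆pq _ (inj₁ refl)) answerSet-disj-fact
                            (pos z) (forced _ Pair-model)))
      where
      fact-model : SatisfiesReduct (Pair p q) (Fact x) (Pair p q)
      fact-model _ refl _ = xz⊆pq _ (inj₁ refl)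

      all-forced : ∀ l → Pair p q l → Forced (P ∪ Fact x) (Pair p q) l
      all-forced l Pl with pq⊆xz l Pl
      ... | inj₁ refl = Forced-∪ʳ Forced-fact
      ... | inj₂ refl = Forced-∪ˡ forced

      answerSet-disj-fact : AnswerSet (DisjProgram p q ∪ Fact x) (Pair p q)
      answerSet-disj-fact = proj₁ (equiv (Fact x) (Pair p q))
        (answerSet-if-forced Pair-consistent (SatisfiesReduct-∪ Pair-model fact-model) all-forced)

    ¬Forced-Pair : p ≢ q → ∀ l → Pair p q l → ¬ Forced P (Pair p q) l
    ¬Forced-Pair p≢q _ (inj₁ refl) = ¬Forced-second p≢q Pair-swap Pair-swap
    ¬Forced-Pair p≢q _ (inj₂ refl) = ¬Forced-second (p≢q ∘ sym) (λ _ → id) (λ _ → id)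

    ∅-model-P : p ≢ q → Nondisjunctive P → SatisfiesReduct ∅ P (Pair p q)
    ∅-model-P p≢q nondisj r Pr ∅⊨B
      with nondisjunctiveHead-reduct (nondisj r Pr) (Pair-model r Pr (⊨red-mono ∅-⊆ (body r) ∅⊨B))
    ... | inj₁ (l , head≡l , Pl) = ⊥-elim (¬Forced-Pair p≢q l Pl (Forced-by-rule Pr head≡l ∅⊨B))
    ... | inj₂ holds-everywhere = holds-everywhere ∅

proposition1 : (Atom : Set) (p q : Atom) → p ≢ q →
    (P : NestedPrograms.Program Atom) → NestedPrograms.Nondisjunctive Atom P →
    ¬ NestedPrograms.StronglyEquivalent Atom P (NestedPrograms.DisjProgram Atom p q)
proposition1 Atom p q p≢q P nondisj equiv =
  answerSet-empty-if-∅-model (answerSet-P-loop equiv)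
    (SatisfiesReduct-∪ (∅-model-P equiv p≢q nondisj) ∅-model-loop) (pos p) (inj₁ refl)
  where open NestedPrograms Atom
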